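{- Consider the goldbug system: every positive integer $i\ge1$ carries an arrow, Inbound or Outbound, all initially Outbound; $0$ and $-1$ are cups. Bugs are released one at a time at site $1$; a bug at $i\ge1$ flips the arrow at $i$, then hops to $i-2$ if it now points Inbound and to $i+1$ if it now points Outbound; a bug reaching $0$ or $-1$ stops, and then the next bug is released. Let $(f_k)_{k\in\mathbb Z}$ be the Fibonacci numbers extended to all integers by $f_0=0$, $f_1=1$, $f_{k+1}=f_k+f_{k-1}$. After $n$ bugs have landed, let $I\subset\{1,2,\dots\}$ be the (finite) set of sites whose arrows point Inbound, and let $L$ and $R$ be the numbers of these $n$ bugs that landed in the cup at $-1$ and at $0$ respectively. Then $$\sum_{i\in I} f_{i+1}=n,\qquad \sum_{i\in I} f_i = L,\qquad \sum_{i\in I} f_{i-1}=R.$$ -}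

module Defs where

open import Data.Nat using (ℕ; zero; suc; _+_; _<_)
open import Data.Nat.Properties using (_≟_)
open import Data.Integer using (ℤ; +_; -[1+_]) renaming (_-_ to _-ℤ_)
open import Data.Bool using (Bool; true; false; not; if_then_else_)
open import Relation.Nullary using (yes; no)

-- Fibonacci numbers f 0 = 0, f 1 = 1, f (k+2) = f (k+1) + f k.
-- Only non-negative indices are needed: the statement uses f_{i-1}
-- with i ≥ 1, so the smallest index is 0.
fib : ℕ → ℕ
fib zero = zero
fib (suc zero) = suc zero
fib (suc (suc k)) = fib (suc k) + fib k

-- Arrow configuration: site i (i ≥ 1) points Inbound iff arrows i ≡ true.
-- (Index 0 is unused; it is never flipped and stays false.)
Arrows : Set
Arrows = ℕ → Bool

allOutbound : Arrows
allOutbound _ = false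

flipAt : ℕ → Arrows → Arrows
flipAt i a j with j ≟ i
... | yes _ = not (a j)
... | no  _ = a j

data Cup : Set where
  cupL cupR : Cup

-- Walk a p a' c : a bug at integer position p, with arrow configuration a,
-- eventually lands in cup c, leaving arrow configuration a'.
data Walk : Arrows → ℤ → Arrows → Cup → Set where
  landR : ∀ {a} → Walk a (+ 0) a cupR
  landL : ∀ {a} → Walk a -[1+ 0 ] a cupL
  hop   : ∀ {a a' c} (k : ℕ) →
          Walk (flipAt (suc k) a)
               (if flipAt (suc k) a (suc k)
                  then (+ suc k) -ℤ (+ 2)
                  else + suc (suc k))
               a' c →
          Walk a (+ suc k) a' c

countL countR : Cup → ℕ
countL cupL = 1
countL cupR = 0
countR cupL = 0
countR cupR = 1

-- Run n a L R : after n bugs (each released at site 1) have landed,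
-- the arrows are a, L bugs landed at -1 and R bugs at 0.
data Run : ℕ → Arrows → ℕ → ℕ → Set where
  start : Run 0 allOutbound 0 0
  next  : ∀ {n a a' L R c} → Run n a L R → Walk a (+ 1) a' c →
          Run (suc n) a' (L + countL c) (R + countR c)

ΣInbound : Arrows → ℕ → (ℕ → ℕ) → ℕ
ΣInbound a zero g = 0
ΣInbound a (suc N) g = ΣInbound a N g + (if a (suc N) then g (suc N) else 0)

SupportedBy : Arrows → ℕ → Set
SupportedBy a N = ∀ i → N < i → a i ≡ false
  where open import Relation.Binary.PropositionalEquality using (_≡_)

{-# OPTIONS --safe #-}
module Submission where

-- Each identity is a conservation law.  For a shift s, weight an Inbound site
-- i by g i = f (s + i - 1) and a bug at position p by h p = f (s + p).  The
-- Fibonacci recurrence makes every hop preserve  Σ_{i ∈ I} g i + h (bug):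
-- flipping i to Inbound adds g i while the jump i → i - 2 lowers h by g i, and
-- flipping i to Outbound removes g i while the step i → i + 1 raises h by g i.
-- Hence n h(1) = Σ_I g + L h(-1) + R h(0).  The shifts s = 2, 1, 0 give
-- (h(1), h(-1), h(0)) = (2, 1, 1), (1, 0, 1), (1, 1, 0), and with n = L + R
-- the three sums are n, L and R.

open import Defs
open import Data.Nat using (ℕ; zero; suc; _+_; _*_; _∸_; _≤_; _⊔_; z≤n; s≤s)
open import Data.Nat.Properties
open import Data.Integer using (ℤ; -[1+_]) renaming (+_ to pos; _-_ to _-ℤ_)
open import Data.Bool using (true; false; not; if_then_else_)
open import Data.Product using (_×_; _,_)
open import Data.Sum using (inj₁; inj₂)
open import Function using (_∘_)
open import Relation.Nullary using (yes; no; contradiction)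
open import Relation.Binary.PropositionalEquality
  using (_≡_; _≢_; refl; sym; trans; cong; cong₂; ≢-sym; module ≡-Reasoning)
open import Algebra.Properties.CommutativeSemigroup +-commutativeSemigroup
  using (interchange; xy∙z≈xz∙y; xy∙z≈x∙zy; xy∙z≈y∙xz; x∙yz≈xz∙y)

flipAt-self : ∀ i a → flipAt i a i ≡ not (a i)
flipAt-self i a with i ≟ i
... | yes _   = refl
... | no  i≢i = contradiction refl i≢i

flipAt-other : ∀ {i j} a → j ≢ i → flipAt i a j ≡ a j
flipAt-other {i} {j} a j≢i with j ≟ i
... | yes j≡i = contradiction j≡i j≢i
... | no  _   = refl

ΣInbound-cong : ∀ {a b : Arrows} g N → (∀ j → j ≤ N → a j ≡ b j) →
                ΣInbound a N g ≡ ΣInbound b N g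
ΣInbound-cong g zero    a≗b = refl
ΣInbound-cong g (suc N) a≗b
  rewrite ΣInbound-cong g N (λ j j≤N → a≗b j (m≤n⇒m≤1+n j≤N))
        | a≗b (suc N) ≤-refl = refl

ΣInbound-allOutbound : ∀ g N → ΣInbound allOutbound N g ≡ 0
ΣInbound-allOutbound g zero    = refl
ΣInbound-allOutbound g (suc N) = trans (+-identityʳ _) (ΣInbound-allOutbound g N)

ΣInbound-insert : ∀ {a b : Arrows} {i} g N → (∀ j → j ≢ i → a j ≡ b j) →
                  a i ≡ false → b i ≡ true → 1 ≤ i → i ≤ N →
                  ΣInbound b N g ≡ ΣInbound a N g + g i
ΣInbound-insert g zero _ _ _ (s≤s z≤n) ()
ΣInbound-insert {a} {b} {i} g (suc N) a≗b a-out b-in 1≤i i≤1+N with i ≟ suc N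
... | yes refl rewrite a-out | b-in | +-identityʳ (ΣInbound a N g) =
  cong (_+ g i) (sym (ΣInbound-cong g N (λ j j≤N → a≗b j (<⇒≢ (s≤s j≤N)))))
... | no i≢1+N rewrite a≗b (suc N) (≢-sym i≢1+N) =
  trans (cong (_+ last) (ΣInbound-insert g N a≗b a-out b-in 1≤i i≤N))
        (xy∙z≈xz∙y (ΣInbound a N g) (g i) last)
  where
  i≤N  = ≤-pred (≤∧≢⇒< i≤1+N i≢1+N)
  last = if b (suc N) then g (suc N) else 0

ΣInbound-supported : ∀ {a} g {N M} → SupportedBy a N → N ≤ M →
                     ΣInbound a M g ≡ ΣInbound a N g
ΣInbound-supported g {N} {M} sup N≤M with m≤n⇒m<n∨m≡n N≤M
... | inj₂ refl = refl
ΣInbound-supported g {N} {suc M} sup N≤M | inj₁ N<1+M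
  rewrite sup (suc M) N<1+M =
  trans (+-identityʳ _) (ΣInbound-supported g sup (≤-pred N<1+M))

highestSite : ∀ {a p a' c} → Walk a p a' c → ℕ
highestSite landR     = 0
highestSite landL     = 0
highestSite (hop k w) = suc k ⊔ highestSite w

highestSiteRun : ∀ {n a L R} → Run n a L R → ℕ
highestSiteRun start      = 0
highestSiteRun (next r w) = highestSiteRun r ⊔ highestSite w

cupPos : Cup → ℤ
cupPos cupL = -[1+ 0 ]
cupPos cupR = pos 0

run-count : ∀ {n a L R} → Run n a L R → L + R ≡ n
run-count start = refl
run-count (next {n} {L = L} {R} {c} r w) =
  trans (interchange L (countL c) R (countR c))
        (trans (cong₂ _+_ (run-count r) (cup-count c)) (+-comm n 1))
  where
  cup-count : ∀ c → countL c + countR c ≡ 1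
  cup-count cupL = refl
  cup-count cupR = refl

-- The two level equations are exactly the two branches of a hop in 'Walk'.
record Potential : Set where
  field
    weight         : ℕ → ℕ
    level          : ℤ → ℕ
    level-outbound : ∀ k → level (pos (suc (suc k)))
                             ≡ level (pos (suc k)) + weight (suc k)
    level-inbound  : ∀ k → level (pos (suc k))
                             ≡ level (pos (suc k) -ℤ pos 2) + weight (suc k)

module _ (P : Potential) where
  open Potential P
  open ≡-Reasoning

  flip-inbound : ∀ {a k N} → a (suc k) ≡ false → suc k ≤ N →
                 ΣInbound a N weight + level (pos (suc k))
                   ≡ ΣInbound (flipAt (suc k) a) N weight + level (pos (suc k) -ℤ pos 2)
  flip-inbound {a} {k} {N} was k<N = begin
    Σa + level (pos (suc k))             ≡⟨ cong (Σa +_) (level-inbound k) ⟩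
    Σa + (level below + weight (suc k))  ≡⟨ x∙yz≈xz∙y Σa _ _ ⟩
    Σa + weight (suc k) + level below    ≡⟨ cong (_+ level below) flip-adds ⟨
    Σflip + level below                  ∎
    where
    Σa    = ΣInbound a N weight
    Σflip = ΣInbound (flipAt (suc k) a) N weight
    below = pos (suc k) -ℤ pos 2
    flip-adds : Σflip ≡ Σa + weight (suc k)
    flip-adds = ΣInbound-insert weight N (λ _ → sym ∘ flipAt-other a) was
                  (trans (flipAt-self (suc k) a) (cong not was)) (s≤s z≤n) k<N

  flip-outbound : ∀ {a k N} → a (suc k) ≡ true → suc k ≤ N →
                  ΣInbound a N weight + level (pos (suc k))
                    ≡ ΣInbound (flipAt (suc k) a) N weight + level (pos (suc (suc k)))
  flip-outbound {a} {k} {N} was k<N = begin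
    Σa + here                       ≡⟨ cong (_+ here) flip-removes ⟩
    Σflip + weight (suc k) + here   ≡⟨ xy∙z≈x∙zy Σflip _ _ ⟩
    Σflip + (here + weight (suc k)) ≡⟨ cong (Σflip +_) (level-outbound k) ⟨
    Σflip + level (pos (suc (suc k))) ∎
    where
    Σa    = ΣInbound a N weight
    Σflip = ΣInbound (flipAt (suc k) a) N weight
    here  = level (pos (suc k))
    flip-removes : Σa ≡ Σflip + weight (suc k)
    flip-removes = ΣInbound-insert weight N (λ _ → flipAt-other a)
                     (trans (flipAt-self (suc k) a) (cong not was)) was (s≤s z≤n) k<N

  walk-conserves : ∀ {a p a' c N} (w : Walk a p a' c) → highestSite w ≤ N →
                   ΣInbound a N weight + level p ≡ ΣInbound a' N weight + level (cupPos c)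
  walk-conserves landR _ = refl
  walk-conserves landL _ = refl
  walk-conserves {a} (hop k w) bound
    with a (suc k) in was | flipAt (suc k) a (suc k) | flipAt-self (suc k) a
  ... | false | .true  | refl =
    trans (flip-inbound was (m⊔n≤o⇒m≤o (suc k) (highestSite w) bound))
          (walk-conserves w (m⊔n≤o⇒n≤o (suc k) (highestSite w) bound))
  ... | true  | .false | refl =
    trans (flip-outbound was (m⊔n≤o⇒m≤o (suc k) (highestSite w) bound))
          (walk-conserves w (m⊔n≤o⇒n≤o (suc k) (highestSite w) bound))

  cup-level : ∀ c → countL c * level (cupPos cupL) + countR c * level (cupPos cupR)
                      ≡ level (cupPos c)
  cup-level cupL = trans (+-identityʳ _) (+-identityʳ _)
  cup-level cupR = +-identityʳ _

  run-conserves : ∀ {n a L R M} (r : Run n a L R) → highestSiteRun r ≤ M →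
                  ΣInbound a M weight + (L * level (cupPos cupL) + R * level (cupPos cupR))
                    ≡ n * level (pos 1)
  run-conserves {M = M} start _ = trans (+-identityʳ _) (ΣInbound-allOutbound weight M)
  run-conserves {M = M} (next {n} {a} {a'} {L} {R} {c} r w) bound = begin
    Σa' + ((L + countL c) * ℓL + (R + countR c) * ℓR)
      ≡⟨ cong (Σa' +_) (cong₂ _+_ (*-distribʳ-+ ℓL L _) (*-distribʳ-+ ℓR R _)) ⟩
    Σa' + ((L * ℓL + countL c * ℓL) + (R * ℓR + countR c * ℓR))
      ≡⟨ cong (Σa' +_) (interchange (L * ℓL) _ (R * ℓR) _) ⟩
    Σa' + (landed + (countL c * ℓL + countR c * ℓR))
      ≡⟨ cong (λ t → Σa' + (landed + t)) (cup-level c) ⟩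
    Σa' + (landed + level (cupPos c))
      ≡⟨ x∙yz≈xz∙y Σa' landed _ ⟩
    Σa' + level (cupPos c) + landed
      ≡⟨ cong (_+ landed) (walk-conserves w w-bound) ⟨
    Σa + level (pos 1) + landed
      ≡⟨ xy∙z≈y∙xz Σa _ landed ⟩
    level (pos 1) + (Σa + landed)
      ≡⟨ cong (level (pos 1) +_) (run-conserves r r-bound) ⟩
    level (pos 1) + n * level (pos 1) ∎
    where
    Σa      = ΣInbound a M weight
    Σa'     = ΣInbound a' M weight
    ℓL      = level (cupPos cupL)
    ℓR      = level (cupPos cupR)
    landed  = L * ℓL + R * ℓR
    r-bound = m⊔n≤o⇒m≤o (highestSiteRun r) (highestSite w) bound
    w-bound = m⊔n≤o⇒n≤o (highestSiteRun r) (highestSite w) bound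

-- f (s - 1), reading f (-1) = 1 off the recurrence
fibPred : ℕ → ℕ
fibPred zero    = 1
fibPred (suc s) = fib s

fib-suc : ∀ s → fib (suc s) ≡ fibPred s + fib s
fib-suc zero    = refl
fib-suc (suc s) = +-comm (fib (suc s)) (fib s)

fibPotential : ℕ → Potential
fibPotential s = record
  { weight         = λ i → fib (s + i ∸ 1)
  ; level          = level
  ; level-outbound = outbound
  ; level-inbound  = inbound
  }
  where
  level : ℤ → ℕ
  level (pos p)  = fib (s + p)
  level -[1+ _ ] = fibPred s

  outbound : ∀ k → fib (s + suc (suc k)) ≡ fib (s + suc k) + fib (s + suc k ∸ 1)
  outbound k rewrite +-suc s (suc k) | +-suc s k = refl

  inbound : ∀ k → fib (s + suc k) ≡ level (pos (suc k) -ℤ pos 2) + fib (s + suc k ∸ 1)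
  inbound zero rewrite +-comm s 1 = fib-suc s
  inbound (suc zero) rewrite +-comm s 2 | +-identityʳ s = +-comm (fib (suc s)) (fib s)
  inbound (suc (suc k)) rewrite +-suc s (suc (suc k)) | +-suc s (suc k) =
    +-comm (fib (suc (s + suc k))) (fib (s + suc k))

module _ {n a L R} (r : Run n a L R) {M} (bound : highestSiteRun r ≤ M) where
  open ≡-Reasoning

  ΣInbound[fib∘suc]≡n : ΣInbound a M (λ i → fib (suc i)) ≡ n
  ΣInbound[fib∘suc]≡n = +-cancelʳ-≡ n _ n (begin
    Σ + n                ≡⟨ cong (Σ +_) (run-count r) ⟨
    Σ + (L + R)          ≡⟨ cong (Σ +_) (cong₂ _+_ (*-identityʳ L) (*-identityʳ R)) ⟨
    Σ + (L * 1 + R * 1)  ≡⟨ run-conserves (fibPotential 2) r bound ⟩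
    n * 2                ≡⟨ *-comm n 2 ⟩
    n + (n + 0)          ≡⟨ cong (n +_) (+-identityʳ n) ⟩
    n + n                ∎)
    where Σ = ΣInbound a M (λ i → fib (suc i))

  ΣInbound[fib]≡L : ΣInbound a M fib ≡ L
  ΣInbound[fib]≡L = +-cancelʳ-≡ R _ L (begin
    Σ + R                ≡⟨ cong (Σ +_) (cong₂ _+_ (*-zeroʳ L) (*-identityʳ R)) ⟨
    Σ + (L * 0 + R * 1)  ≡⟨ run-conserves (fibPotential 1) r bound ⟩
    n * 1                ≡⟨ *-identityʳ n ⟩
    n                    ≡⟨ run-count r ⟨
    L + R                ∎)
    where Σ = ΣInbound a M fib

  ΣInbound[fib∘pred]≡R : ΣInbound a M (λ i → fib (i ∸ 1)) ≡ R
  ΣInbound[fib∘pred]≡R = +-cancelʳ-≡ L _ R (begin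
    Σ + L                ≡⟨ cong (Σ +_) (+-identityʳ L) ⟨
    Σ + (L + 0)          ≡⟨ cong (Σ +_) (cong₂ _+_ (*-identityʳ L) (*-zeroʳ R)) ⟨
    Σ + (L * 1 + R * 0)  ≡⟨ run-conserves (fibPotential 0) r bound ⟩
    n * 1                ≡⟨ *-identityʳ n ⟩
    n                    ≡⟨ run-count r ⟨
    L + R                ≡⟨ +-comm L R ⟩
    R + L                ∎)
    where Σ = ΣInbound a M (λ i → fib (i ∸ 1))

mainTheorem4 : ∀ (n : ℕ) (a : Arrows) (L R : ℕ) → Run n a L R →
                 ∀ (N : ℕ) → SupportedBy a N →
                 (ΣInbound a N (λ i → fib (suc i)) ≡ n)
                 × (ΣInbound a N fib ≡ L)
                 × (ΣInbound a N (λ i → fib (i ∸ 1)) ≡ R)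
mainTheorem4 n a L R r N sup =
  restrict (ΣInbound[fib∘suc]≡n r bound) ,
  restrict (ΣInbound[fib]≡L r bound) ,
  restrict (ΣInbound[fib∘pred]≡R r bound)
  where
  M     = highestSiteRun r ⊔ N
  bound = m≤m⊔n (highestSiteRun r) N
  restrict : ∀ {g x} → ΣInbound a M g ≡ x → ΣInbound a N g ≡ x
  restrict {g} = trans (sym (ΣInbound-supported g sup (m≤n⊔m (highestSiteRun r) N)))
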